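{- Let $H=(U,V,E)$ be a finite connected bipartite graph with $|U|\le|V|$. Then: (i) the graph $St(H)$ is enumeratively K\H{o}nig-Egerv\'ary, i.e. every minimum vertex cover $\mathcal{C}$ of $St(H)$ satisfies $\mathcal{C}=K_{\mathcal{M}}(St(H))$ for some maximal matching $\mathcal{M}$ of $St(H)$; and (ii) for every minimum vertex cover $\mathcal{C}$ of $H$ there is a maximal matching $\mathcal{M}$ of $St(H)$ such that $K_{\mathcal{M}}(St(H))\cap V(H)=\mathcal{C}$.
   Context: Let $3\star$ denote the star $K_{1,3}$. $St(H)$ is obtained from $H$ by attaching a copy of $3\star$ to every vertex $x$ of $H$, attaching meaning identifying $x$ with one leaf of a new copy of $3\star$ (equivalently: add a new vertex $c_x$ adjacent to $x$ and two new degree-one vertices adjacent to $c_x$). $St(H)$ is bipartite with bipartition $(X,Y)$ where $U\subseteq X$, $V\subseteq Y$ and $|X|\le|Y|$; K\H{o}nig's procedure on $St(H)$ is applied with $X$ as the smaller side. A matching is a set of pairwise vertex-disjoint edges; it is maximal if no edge can be added to it; a vertex is saturated if it is an endpoint of a matching edge. For a bipartite graph $G=(A,B,F)$ with designated smaller side $A$ and a matching $\mathcal{M}$, an alternating path is a path whose edges alternate between edges not in $\mathcal{M}$ and edges in $\mathcal{M}$; $Z_{\mathcal{M}}(G)$ is the set of vertices reachable by alternating paths starting at vertices of $A$ unsaturated by $\mathcal{M}$ (these start vertices included), and $K_{\mathcal{M}}(G):=(A\setminus Z_{\mathcal{M}}(G))\cup(B\cap Z_{\mathcal{M}}(G))$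 (K\H{o}nig's procedure). A minimum vertex cover is a vertex set meeting every edge, of smallest possible size. -}

module Defs where

open import Data.Nat using (ℕ; _+_; _≤_)
open import Data.Fin using (Fin; splitAt; _↑ˡ_; _↑ʳ_; _≟_)
open import Data.Fin.Subset using (Subset; _∈_; ∣_∣)
open import Data.Bool using (Bool; true; false; T; _∨_; _∧_)
open import Data.Sum using (_⊎_; inj₁; inj₂)
open import Data.Product using (_×_; ∃; Σ)
open import Relation.Nullary using (¬_)
open import Relation.Nullary.Decidable using (⌊_⌋)
open import Relation.Binary.PropositionalEquality using (_≡_)

-- A finite bipartite graph G = (A, B, F) with A = Fin a, B = Fin b and
-- edge set given by a Boolean adjacency relation F : Fin a → Fin b → Bool.
-- A is the designated (smaller) side used by Kőnig's procedure.

Edges : ℕ → ℕ → Set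
Edges a b = Fin a → Fin b → Bool

VSet : ℕ → ℕ → Set
VSet a b = Subset a × Subset b

size : ∀ {a b} → VSet a b → ℕ
size (CA Data.Product., CB) = ∣ CA ∣ + ∣ CB ∣

IsVertexCover : ∀ {a b} → Edges a b → VSet a b → Set
IsVertexCover {a} {b} F (CA Data.Product., CB) =
  (x : Fin a) (y : Fin b) → T (F x y) → (x ∈ CA) ⊎ (y ∈ CB)

IsMinVertexCover : ∀ {a b} → Edges a b → VSet a b → Set
IsMinVertexCover F C =
  IsVertexCover F C × (∀ C' → IsVertexCover F C' → size C ≤ size C')

IsMatching : ∀ {a b} → Edges a b → Edges a b → Set
IsMatching {a} {b} F M =
  ((x : Fin a) (y : Fin b) → T (M x y) → T (F x y)) ×
  ((x : Fin a) (y y' : Fin b) → T (M x y) → T (M x y') → y ≡ y') ×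
  ((x x' : Fin a) (y : Fin b) → T (M x y) → T (M x' y) → x ≡ x')

addEdge : ∀ {a b} → Edges a b → Fin a → Fin b → Edges a b
addEdge M x y x' y' = M x' y' ∨ (⌊ x' ≟ x ⌋ ∧ ⌊ y' ≟ y ⌋)

IsMaximalMatching : ∀ {a b} → Edges a b → Edges a b → Set
IsMaximalMatching {a} {b} F M =
  IsMatching F M ×
  ((x : Fin a) (y : Fin b) → T (F x y) → ¬ T (M x y) →
     ¬ IsMatching F (addEdge M x y))

SaturatedA : ∀ {a b} → Edges a b → Fin a → Set
SaturatedA M x = ∃ λ y → T (M x y)

-- Z_M(G): vertices reachable by M-alternating paths starting at
-- M-unsaturated vertices of A (start vertices included).  inj₁ = A-vertex,
-- inj₂ = B-vertex.
data Z {a b} (F M : Edges a b) : Fin a ⊎ Fin b → Set where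
  start  : ∀ {x} → ¬ SaturatedA M x → Z F M (inj₁ x)
  nonM   : ∀ {x y} → Z F M (inj₁ x) → T (F x y) → ¬ T (M x y) → Z F M (inj₂ y)
  viaM   : ∀ {x y} → Z F M (inj₂ y) → T (M x y) → Z F M (inj₁ x)

KA : ∀ {a b} → Edges a b → Edges a b → Fin a → Set
KA F M x = ¬ Z F M (inj₁ x)

KB : ∀ {a b} → Edges a b → Edges a b → Fin b → Set
KB F M y = Z F M (inj₂ y)

CoverIsKonig : ∀ {a b} → Edges a b → Edges a b → VSet a b → Set
CoverIsKonig {a} {b} F M (CA Data.Product., CB) =
  ((x : Fin a) → (x ∈ CA → KA F M x) × (KA F M x → x ∈ CA)) ×
  ((y : Fin b) → (y ∈ CB → KB F M y) × (KB F M y → y ∈ CB))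

data Reach {m n} (E : Edges m n) : Fin m ⊎ Fin n → Fin m ⊎ Fin n → Set where
  here  : ∀ {p} → Reach E p p
  stepUV : ∀ {p u v} → Reach E p (inj₁ u) → T (E u v) → Reach E p (inj₂ v)
  stepVU : ∀ {p u v} → Reach E p (inj₂ v) → T (E u v) → Reach E p (inj₁ u)

Connected : ∀ {m n} → Edges m n → Set
Connected {m} {n} E = (p q : Fin m ⊎ Fin n) → Reach E p q

-- For H = (U, V, E) with U = Fin m, V = Fin n:
--   X = U ⊎ {c_v : v ∈ V} ⊎ {leaf₀ of c_u : u ∈ U} ⊎ {leaf₁ of c_u : u ∈ U}
--     encoded as Fin (m + (n + (m + m))) in this order;
--   Y = V ⊎ {c_u : u ∈ U} ⊎ {leaf₀ of c_v : v ∈ V} ⊎ {leaf₁ of c_v : v ∈ V}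
--     encoded as Fin (n + (m + (n + n))) in this order.

StX : ℕ → ℕ → ℕ
StX m n = m + (n + (m + m))

StY : ℕ → ℕ → ℕ
StY m n = n + (m + (n + n))

data XView (m n : ℕ) : Set where
  xU  : Fin m → XView m n
  xC  : Fin n → XView m n   -- centre c_v, v ∈ V
  xL₀ : Fin m → XView m n   -- first leaf at c_u, u ∈ U
  xL₁ : Fin m → XView m n   -- second leaf at c_u, u ∈ U

data YView (m n : ℕ) : Set where
  yV  : Fin n → YView m n
  yC  : Fin m → YView m n   -- centre c_u, u ∈ U
  yL₀ : Fin n → YView m n   -- first leaf at c_v, v ∈ V
  yL₁ : Fin n → YView m n   -- second leaf at c_v, v ∈ V

viewX : ∀ m n → Fin (StX m n) → XView m n
viewX m n i with splitAt m i
... | inj₁ u = xU u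
... | inj₂ j with splitAt n j
...   | inj₁ v = xC v
...   | inj₂ k with splitAt m k
...     | inj₁ u = xL₀ u
...     | inj₂ u = xL₁ u

viewY : ∀ m n → Fin (StY m n) → YView m n
viewY m n i with splitAt n i
... | inj₁ v = yV v
... | inj₂ j with splitAt m j
...   | inj₁ u = yC u
...   | inj₂ k with splitAt n k
...     | inj₁ v = yL₀ v
...     | inj₂ v = yL₁ v

stEdge : ∀ {m n} → Edges m n → XView m n → YView m n → Bool
stEdge E (xU u)  (yV v)  = E u v
stEdge E (xU u)  (yC u') = ⌊ u ≟ u' ⌋
stEdge E (xL₀ u) (yC u') = ⌊ u ≟ u' ⌋
stEdge E (xL₁ u) (yC u') = ⌊ u ≟ u' ⌋
stEdge E (xC v)  (yV v') = ⌊ v ≟ v' ⌋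
stEdge E (xC v)  (yL₀ v') = ⌊ v ≟ v' ⌋
stEdge E (xC v)  (yL₁ v') = ⌊ v ≟ v' ⌋
stEdge E _ _ = false

-- St(H) as a bipartite graph with smaller side X.
St : ∀ {m n} → Edges m n → Edges (StX m n) (StY m n)
St {m} {n} E x y = stEdge E (viewX m n x) (viewY m n y)

embU : ∀ {m} n → Fin m → Fin (StX m n)
embU {m} n u = u ↑ˡ (n + (m + m))

embV : ∀ {n} m → Fin n → Fin (StY m n)
embV {n} m v = v ↑ˡ (m + (n + n))

-- A minimum vertex cover (CA, CB) of a bipartite graph is tight: by Hall's theorem (in Rado's
-- edge-deletion form) CA can be matched into the uncovered side, and every vertex of CB has a
-- neighbour outside CA.  In St(H) a minimum cover contains every centre c_x and no leaf, because a
-- centre outside the cover forces both of its leaves in, and trading them for the centre gives a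
-- smaller cover; so the cover is its trace C on V(H) plus all centres, and C inherits tightness.
-- From a tight cover C of H one builds a maximal matching M of St(H): u ∈ C goes to its Hall
-- partner and c_u to a leaf, u ∉ C goes to c_u, and every c_v to a leaf.  The M-alternating paths
-- from the unsaturated leaves at the c_u reach exactly those leaves, all c_u, U ∖ C and V ∩ C, so
-- K_M(St H) is C together with all centres, which gives both (i) and (ii).

module Submission where

open import Data.Bool using (true; false; T)
open import Data.Bool.Properties using (T?; T-∨; T-∧)
open import Data.Empty using (⊥; ⊥-elim)
open import Data.Fin using (Fin; _≟_; _↑ˡ_; _↑ʳ_; splitAt)
open import Data.Fin.Properties
  using (any?; punchInᵢ≢i; splitAt-↑ˡ; splitAt-↑ʳ; splitAt⁻¹-↑ˡ; splitAt⁻¹-↑ʳ)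
open import Data.Fin.Subset hiding (⊥; ⊤)
open import Data.Fin.Subset.Properties
open import Data.Maybe using (Maybe; just; nothing)
open import Data.Maybe.Properties using (just-injective) renaming (≡-dec to ≡-decMaybe)
open import Data.Nat using (ℕ; suc; _+_; _≤_; _<_; z≤n; s≤s; s≤s⁻¹)
open import Data.Nat.Properties hiding (_≟_)
open import Algebra.Properties.CommutativeMonoid.Sum +-0-commutativeMonoid
  using (sum; sum-remove; sum-cong-≗)
open import Data.Product using (_×_; _,_; ∃; proj₁; proj₂)
import Data.Sum
open import Data.Sum using (_⊎_; inj₁; inj₂; [_,_])
open import Data.Unit using (⊤; tt)
open import Data.Vec using ([]; _∷_; tabulate; here; there)
open import Data.Vec.Functional using (updateAt; removeAt)
open import Data.Vec.Functional.Properties using (updateAt-updates; updateAt-minimal)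
open import Data.Vec.Properties using (lookup⇒[]=; []=⇒lookup; lookup∘tabulate)
open import Function using (_∘_; _⇔_; mk⇔; Equivalence)
import Function.Properties.Equivalence as ⇔
open import Relation.Binary.PropositionalEquality
  using (_≡_; _≢_; refl; sym; trans; cong; subst; subst₂)
open import Relation.Nullary using (¬_; Dec; yes; no; ¬?)
open import Relation.Nullary.Decidable using (⌊_⌋; toWitness; fromWitness; decidable-stable; _×-dec_)
import Relation.Nullary.Decidable as Dec
open import Relation.Unary using (Decidable)

open import Defs

private variable
  n : ℕ

⟦_⟧ : {P : Fin n → Set} → Decidable P → Subset n
⟦ P? ⟧ = tabulate (λ x → ⌊ P? x ⌋)

module _ {P : Fin n → Set} (P? : Decidable P) where

  ∈⟦⟧⁺ : ∀ {x} → P x → x ∈ ⟦ P? ⟧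
  ∈⟦⟧⁺ {x} px = lookup⇒[]= x ⟦ P? ⟧ (trans (lookup∘tabulate _ x) (isYes (P? x)))
    where
    isYes : (p? : Dec (P x)) → ⌊ p? ⌋ ≡ true
    isYes (yes _)  = refl
    isYes (no ¬px) = ⊥-elim (¬px px)

  ∈⟦⟧⁻ : ∀ {x} → x ∈ ⟦ P? ⟧ → P x
  ∈⟦⟧⁻ {x} x∈ = toWitness (subst T (trans (sym ([]=⇒lookup x∈)) (lookup∘tabulate _ x)) _)

∣p∪q∣+∣p∩q∣≡∣p∣+∣q∣ : (p q : Subset n) → ∣ p ∪ q ∣ + ∣ p ∩ q ∣ ≡ ∣ p ∣ + ∣ q ∣
∣p∪q∣+∣p∩q∣≡∣p∣+∣q∣ []          []          = refl
∣p∪q∣+∣p∩q∣≡∣p∣+∣q∣ (true ∷ p)  (true ∷ q)  =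
  cong suc (trans (+-suc ∣ p ∪ q ∣ ∣ p ∩ q ∣)
                  (trans (cong suc (∣p∪q∣+∣p∩q∣≡∣p∣+∣q∣ p q)) (sym (+-suc ∣ p ∣ ∣ q ∣))))
∣p∪q∣+∣p∩q∣≡∣p∣+∣q∣ (true ∷ p)  (false ∷ q) = cong suc (∣p∪q∣+∣p∩q∣≡∣p∣+∣q∣ p q)
∣p∪q∣+∣p∩q∣≡∣p∣+∣q∣ (false ∷ p) (true ∷ q)  =
  trans (cong suc (∣p∪q∣+∣p∩q∣≡∣p∣+∣q∣ p q)) (sym (+-suc ∣ p ∣ ∣ q ∣))
∣p∪q∣+∣p∩q∣≡∣p∣+∣q∣ (false ∷ p) (false ∷ q) = ∣p∪q∣+∣p∩q∣≡∣p∣+∣q∣ p q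

∣p∪q∣≤∣p∣+∣q∣ : (p q : Subset n) → ∣ p ∪ q ∣ ≤ ∣ p ∣ + ∣ q ∣
∣p∪q∣≤∣p∣+∣q∣ p q = subst (∣ p ∪ q ∣ ≤_) (∣p∪q∣+∣p∩q∣≡∣p∣+∣q∣ p q) (m≤m+n _ _)

∣p─q∣+∣p∩q∣≡∣p∣ : (p q : Subset n) → ∣ p ─ q ∣ + ∣ p ∩ q ∣ ≡ ∣ p ∣
∣p─q∣+∣p∩q∣≡∣p∣ []          []          = refl
∣p─q∣+∣p∩q∣≡∣p∣ (true ∷ p)  (true ∷ q)  =
  trans (+-suc ∣ p ─ q ∣ ∣ p ∩ q ∣) (cong suc (∣p─q∣+∣p∩q∣≡∣p∣ p q))
∣p─q∣+∣p∩q∣≡∣p∣ (true ∷ p)  (false ∷ q) = cong suc (∣p─q∣+∣p∩q∣≡∣p∣ p q)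
∣p─q∣+∣p∩q∣≡∣p∣ (false ∷ p) (true ∷ q)  = ∣p─q∣+∣p∩q∣≡∣p∣ p q
∣p─q∣+∣p∩q∣≡∣p∣ (false ∷ p) (false ∷ q) = ∣p─q∣+∣p∩q∣≡∣p∣ p q

x∈p─q⇒x∉q : ∀ {x : Fin n} (p q : Subset n) → x ∈ p ─ q → x ∉ q
x∈p─q⇒x∉q (s ∷ p) (t ∷ q) (there x∈) (there x∈q) = x∈p─q⇒x∉q p q x∈ x∈q
x∈p─q⇒x∉q (s ∷ p) (true ∷ q) () here

x∈p-y⇒x≢y : ∀ {x y : Fin n} {p} → x ∈ p - y → x ≢ y
x∈p-y⇒x≢y {y = y} {p} x∈ = x∉⁅y⁆⇒x≢y (x∈p─q⇒x∉q p ⁅ y ⁆ x∈)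

x∈p⇒∣p∣≡1+∣p-x∣ : ∀ {x : Fin n} {p} → x ∈ p → ∣ p ∣ ≡ suc ∣ p - x ∣
x∈p⇒∣p∣≡1+∣p-x∣ {p = true ∷ p}  here       = cong (suc ∘ ∣_∣) (sym (p─⊥≡p p))
x∈p⇒∣p∣≡1+∣p-x∣ {p = true ∷ p}  (there x∈) = cong suc (x∈p⇒∣p∣≡1+∣p-x∣ x∈)
x∈p⇒∣p∣≡1+∣p-x∣ {p = false ∷ p} (there x∈) = x∈p⇒∣p∣≡1+∣p-x∣ x∈

x∈p⇒⁅x⁆⊆p : ∀ {x : Fin n} {p} → x ∈ p → ⁅ x ⁆ ⊆ p
x∈p⇒⁅x⁆⊆p {x = x} x∈p y∈ = subst (_∈ _) (sym (x∈⁅y⁆⇒x≡y x y∈)) x∈p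

distinct⇒2≤∣p∣ : ∀ {x y : Fin n} {p} → x ∈ p → y ∈ p → x ≢ y → 2 ≤ ∣ p ∣
distinct⇒2≤∣p∣ {x = x} {y} {p} x∈ y∈ x≢y = begin
  2             ≤⟨ s≤s (subst (1 ≤_) (sym (x∈p⇒∣p∣≡1+∣p-x∣ y∈p-x)) (s≤s z≤n)) ⟩
  suc ∣ p - x ∣ ≡⟨ sym (x∈p⇒∣p∣≡1+∣p-x∣ x∈) ⟩
  ∣ p ∣         ∎
  where
  open ≤-Reasoning
  y∈p-x = x∈p∧x≢y⇒x∈p-y y∈ (x≢y ∘ sym)

1≤∣p∣⇒nonempty : ∀ {p : Subset n} → 1 ≤ ∣ p ∣ → Nonempty p
1≤∣p∣⇒nonempty {n} {p} 1≤∣p∣ with nonempty? p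
... | yes ne = ne
... | no ¬ne = ⊥-elim (1+n≰n (subst (1 ≤_) (trans (cong ∣_∣ (Empty-unique ¬ne)) (∣⊥∣≡0 n)) 1≤∣p∣))

2≤∣p∣⇒distinct : ∀ {p : Subset n} → 2 ≤ ∣ p ∣ → ∃ λ x → ∃ λ y → x ∈ p × y ∈ p × x ≢ y
2≤∣p∣⇒distinct {p = p} 2≤∣p∣ with 1≤∣p∣⇒nonempty (≤-trans (s≤s z≤n) 2≤∣p∣)
... | x , x∈ with 1≤∣p∣⇒nonempty (s≤s⁻¹ (subst (2 ≤_) (x∈p⇒∣p∣≡1+∣p-x∣ x∈) 2≤∣p∣))
...   | y , y∈p-x = x , y , x∈ , p─q⊆p p ⁅ x ⁆ y∈p-x , x∈p-y⇒x≢y y∈p-x ∘ sym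

∣p∣≤1⇒unique : ∀ {x y : Fin n} {p} → ∣ p ∣ ≤ 1 → x ∈ p → y ∈ p → x ≡ y
∣p∣≤1⇒unique {x = x} {y} ∣p∣≤1 x∈ y∈ with x ≟ y
... | yes x≡y = x≡y
... | no  x≢y = ⊥-elim (1+n≰n (≤-trans (distinct⇒2≤∣p∣ x∈ y∈ x≢y) ∣p∣≤1))

sum-<-at : ∀ {t t' : Fin n → ℕ} i → (∀ j → j ≢ i → t' j ≡ t j) → t' i < t i → sum t' < sum t
sum-<-at {suc n} {t} {t'} i same-elsewhere smaller = begin-strict
  sum t'                       ≡⟨ sum-remove t' ⟩
  t' i + sum (removeAt t' i)   ≡⟨ cong (t' i +_) (sum-cong-≗ (λ j → same-elsewhere _ (punchInᵢ≢i i j))) ⟩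
  t' i + sum (removeAt t i)    <⟨ +-monoˡ-< _ smaller ⟩
  t i + sum (removeAt t i)     ≡⟨ sum-remove t ⟨
  sum t                        ∎
  where open ≤-Reasoning

module Hall {a b : ℕ} where

  Family : Set
  Family = Fin a → Subset b

  neighbours : Family → Subset a → Subset b
  neighbours N S = ⟦ (λ y → any? (λ x → x ∈? S ×-dec y ∈? N x)) ⟧

  ∈neighbours⁺ : ∀ {N S x y} → x ∈ S → y ∈ N x → y ∈ neighbours N S
  ∈neighbours⁺ {x = x} x∈S y∈Nx = ∈⟦⟧⁺ _ (x , x∈S , y∈Nx)

  ∈neighbours⁻ : ∀ {N S y} → y ∈ neighbours N S → ∃ λ x → x ∈ S × y ∈ N x
  ∈neighbours⁻ = ∈⟦⟧⁻ _

  HallCondition : Subset a → Family → Set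
  HallCondition P N = ∀ S → S ⊆ P → ∣ S ∣ ≤ ∣ neighbours N S ∣

  record Transversal (P : Subset a) (N : Family) : Set where
    field
      pick           : ∀ {x} → x ∈ P → Fin b
      pick∈          : ∀ {x} (x∈P : x ∈ P) → pick x∈P ∈ N x
      pick-injective : ∀ {x x'} (x∈P : x ∈ P) (x'∈P : x' ∈ P) → pick x∈P ≡ pick x'∈P → x ≡ x'

  transversal-mono : ∀ {P N N'} → (∀ x → N' x ⊆ N x) → Transversal P N' → Transversal P N
  transversal-mono N'⊆N t = record { Transversal t; pick∈ = λ x∈P → N'⊆N _ (Transversal.pick∈ t x∈P) }

  module _ {P : Subset a} {N : Family} (hall : HallCondition P N) where

    ∣Nx∣≥1 : ∀ {x} → x ∈ P → 1 ≤ ∣ N x ∣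
    ∣Nx∣≥1 {x} x∈P = begin
      1                        ≡⟨ sym (∣⁅x⁆∣≡1 x) ⟩
      ∣ ⁅ x ⁆ ∣                ≤⟨ hall ⁅ x ⁆ (x∈p⇒⁅x⁆⊆p x∈P) ⟩
      ∣ neighbours N ⁅ x ⁆ ∣   ≤⟨ p⊆q⇒∣p∣≤∣q∣ neighbours⁅x⁆⊆Nx ⟩
      ∣ N x ∣                  ∎
      where
      open ≤-Reasoning
      neighbours⁅x⁆⊆Nx : neighbours N ⁅ x ⁆ ⊆ N x
      neighbours⁅x⁆⊆Nx y∈ with ∈neighbours⁻ y∈
      ... | x' , x'∈ , y∈Nx' = subst (λ x' → _ ∈ N x') (x∈⁅y⁆⇒x≡y x x'∈) y∈Nx'

    hall-singletons : (∀ {x} → x ∈ P → ∣ N x ∣ ≤ 1) → Transversal P N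
    hall-singletons thin = record { pick = pick ; pick∈ = pick∈ ; pick-injective = injective }
      where
      pick : ∀ {x} → x ∈ P → Fin b
      pick x∈P = proj₁ (1≤∣p∣⇒nonempty (∣Nx∣≥1 x∈P))
      pick∈ : ∀ {x} (x∈P : x ∈ P) → pick x∈P ∈ N x
      pick∈ x∈P = proj₂ (1≤∣p∣⇒nonempty (∣Nx∣≥1 x∈P))
      injective : ∀ {x x'} (x∈P : x ∈ P) (x'∈P : x' ∈ P) → pick x∈P ≡ pick x'∈P → x ≡ x'
      injective {x} {x'} x∈P x'∈P same with x ≟ x'
      ... | yes x≡x' = x≡x'
      ... | no  x≢x' = ⊥-elim (1+n≰n (begin
        2                  ≤⟨ distinct⇒2≤∣p∣ (x∈p∪q⁺ (inj₁ (x∈⁅x⁆ x))) (x∈p∪q⁺ (inj₂ (x∈⁅x⁆ x'))) x≢x' ⟩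
        ∣ S ∣              ≤⟨ hall S S⊆P ⟩
        ∣ neighbours N S ∣ ≤⟨ p⊆q⇒∣p∣≤∣q∣ neighboursS⊆⁅y⁆ ⟩
        ∣ ⁅ pick x∈P ⁆ ∣   ≡⟨ ∣⁅x⁆∣≡1 (pick x∈P) ⟩
        1                  ∎))
        where
        open ≤-Reasoning
        S = ⁅ x ⁆ ∪ ⁅ x' ⁆
        S⊆P : S ⊆ P
        S⊆P z∈ = [ x∈p⇒⁅x⁆⊆p x∈P , x∈p⇒⁅x⁆⊆p x'∈P ] (x∈p∪q⁻ ⁅ x ⁆ ⁅ x' ⁆ z∈)
        neighboursS⊆⁅y⁆ : neighbours N S ⊆ ⁅ pick x∈P ⁆
        neighboursS⊆⁅y⁆ {y} y∈ with ∈neighbours⁻ y∈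
        ... | z , z∈S , y∈Nz with x∈p∪q⁻ ⁅ x ⁆ ⁅ x' ⁆ z∈S
        ... | inj₁ z∈ rewrite x∈⁅y⁆⇒x≡y x z∈ =
          subst (_∈ ⁅ pick x∈P ⁆) (∣p∣≤1⇒unique (thin x∈P) (pick∈ x∈P) y∈Nz) (x∈⁅x⁆ _)
        ... | inj₂ z∈ rewrite x∈⁅y⁆⇒x≡y x' z∈ | same =
          subst (_∈ ⁅ pick x'∈P ⁆) (∣p∣≤1⇒unique (thin x'∈P) (pick∈ x'∈P) y∈Nz) (x∈⁅x⁆ _)

  μ : Family → ℕ
  μ N = sum (λ x → ∣ N x ∣)

  shrink : Family → Fin a → Fin b → Family
  shrink N x y = updateAt N x (_- y)

  shrink-at : ∀ N x y → shrink N x y x ≡ N x - y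
  shrink-at N x y = updateAt-updates x N

  shrink-elsewhere : ∀ N {x} y {z} → z ≢ x → shrink N x y z ≡ N z
  shrink-elsewhere N y z≢x = updateAt-minimal _ _ N z≢x

  shrink-⊆ : ∀ N x y z → shrink N x y z ⊆ N z
  shrink-⊆ N x y z with z ≟ x
  ... | yes refl = subst (_⊆ N z) (sym (shrink-at N z y)) (p─q⊆p (N z) ⁅ y ⁆)
  ... | no  z≢x  = subst (_⊆ N z) (sym (shrink-elsewhere N y z≢x)) (λ y∈ → y∈)

  ∈neighbours-shrink : ∀ {N x y S z w} → z ∈ S → z ≢ x → w ∈ N z → w ∈ neighbours (shrink N x y) S
  ∈neighbours-shrink {N} {y = y} z∈S z≢x w∈Nz =
    ∈neighbours⁺ z∈S (subst (_ ∈_) (sym (shrink-elsewhere N y z≢x)) w∈Nz)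

  μ-shrink : ∀ N x {y} → y ∈ N x → μ (shrink N x y) < μ N
  μ-shrink N x y∈ = sum-<-at x (λ _ z≢x → cong ∣_∣ (shrink-elsewhere N _ z≢x))
    (subst (λ q → ∣ q ∣ < ∣ N x ∣) (sym (shrink-at N x _)) (≤-reflexive (sym (x∈p⇒∣p∣≡1+∣p-x∣ y∈))))

  Deficient : Subset a → Family → Subset a → Set
  Deficient P N S = S ⊆ P × ∣ neighbours N S ∣ < ∣ S ∣

  deficient? : ∀ P N S → Dec (Deficient P N S)
  deficient? P N S = (S ⊆? P) ×-dec (suc ∣ neighbours N S ∣ ≤? ∣ S ∣)

  ¬deficient⇒hall : ∀ {P N} → ¬ (∃ λ S → Deficient P N S) → HallCondition P N
  ¬deficient⇒hall none S S⊆P = ≮⇒≥ (λ deficient → none (S , S⊆P , deficient))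

  module Shrinking {P : Subset a} {N : Family} (hall : HallCondition P N) {x : Fin a} where

    deficient-contains : ∀ {y S} → Deficient P (shrink N x y) S → x ∈ S
    deficient-contains {y} {S} (S⊆P , deficient) with x ∈? S
    ... | yes x∈S = x∈S
    ... | no  x∉S = ⊥-elim (<⇒≱ deficient (≤-trans (hall S S⊆P) (p⊆q⇒∣p∣≤∣q∣ unchanged)))
      where
      unchanged : neighbours N S ⊆ neighbours (shrink N x y) S
      unchanged w∈ with ∈neighbours⁻ w∈
      ... | z , z∈S , w∈Nz = ∈neighbours-shrink z∈S (λ { refl → x∉S z∈S }) w∈Nz

    -- If both shrinkings had deficient sets S₁, S₂, submodularity of |neighbours N _| on
    -- S₁ ∪ S₂ and (S₁ ∩ S₂) - x would violate Hall's condition for N.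
    not-both-deficient : ∀ {y₁ y₂ S₁ S₂} → y₁ ≢ y₂ →
      Deficient P (shrink N x y₁) S₁ → Deficient P (shrink N x y₂) S₂ → ⊥
    not-both-deficient {y₁} {y₂} {S₁} {S₂} y₁≢y₂ d₁@(S₁⊆P , deficient₁) d₂@(S₂⊆P , deficient₂) =
      <-irrefl refl (begin-strict
      ∣ S₁ ∣ + ∣ S₂ ∣                        ≡⟨ ∣p∪q∣+∣p∩q∣≡∣p∣+∣q∣ S₁ S₂ ⟨
      ∣ S₁ ∪ S₂ ∣ + ∣ S₁ ∩ S₂ ∣              ≡⟨ cong (∣ S₁ ∪ S₂ ∣ +_) (x∈p⇒∣p∣≡1+∣p-x∣ x∈S₁∩S₂) ⟩
      ∣ S₁ ∪ S₂ ∣ + suc ∣ I ∣                ≡⟨ +-suc ∣ S₁ ∪ S₂ ∣ ∣ I ∣ ⟩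
      suc (∣ S₁ ∪ S₂ ∣ + ∣ I ∣)              ≤⟨ s≤s (+-mono-≤ hall-∪ hall-I) ⟩
      suc (∣ A₁ ∪ A₂ ∣ + ∣ A₁ ∩ A₂ ∣)        ≡⟨ cong suc (∣p∪q∣+∣p∩q∣≡∣p∣+∣q∣ A₁ A₂) ⟩
      suc (∣ A₁ ∣ + ∣ A₂ ∣)                  <⟨ s≤s (+-monoʳ-< ∣ A₁ ∣ deficient₂) ⟩
      suc ∣ A₁ ∣ + ∣ S₂ ∣                    ≤⟨ +-monoˡ-≤ ∣ S₂ ∣ deficient₁ ⟩
      ∣ S₁ ∣ + ∣ S₂ ∣                        ∎)
      where
      open ≤-Reasoning
      A₁ = neighbours (shrink N x y₁) S₁
      A₂ = neighbours (shrink N x y₂) S₂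
      I = (S₁ ∩ S₂) - x
      x∈S₁ = deficient-contains d₁
      x∈S₂ = deficient-contains d₂
      x∈S₁∩S₂ = x∈p∩q⁺ (x∈S₁ , x∈S₂)
      keptAt : ∀ {y S w} → x ∈ S → w ∈ N x → w ≢ y → w ∈ neighbours (shrink N x y) S
      keptAt {y} x∈S w∈Nx w≢y =
        ∈neighbours⁺ x∈S (subst (_ ∈_) (sym (shrink-at N x y)) (x∈p∧x≢y⇒x∈p-y w∈Nx w≢y))
      ∪-covered : neighbours N (S₁ ∪ S₂) ⊆ A₁ ∪ A₂
      ∪-covered {w} w∈ with ∈neighbours⁻ w∈
      ... | z , z∈S₁∪S₂ , w∈Nz with z ≟ x
      ...   | no z≢x = x∈p∪q⁺ (Data.Sum.map (λ z∈ → ∈neighbours-shrink z∈ z≢x w∈Nz)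
                                            (λ z∈ → ∈neighbours-shrink z∈ z≢x w∈Nz) (x∈p∪q⁻ S₁ S₂ z∈S₁∪S₂))
      ...   | yes refl with w ≟ y₁
      ...     | no  w≢y₁ = x∈p∪q⁺ (inj₁ (keptAt x∈S₁ w∈Nz w≢y₁))
      ...     | yes refl = x∈p∪q⁺ (inj₂ (keptAt x∈S₂ w∈Nz y₁≢y₂))
      I-covered : neighbours N I ⊆ A₁ ∩ A₂
      I-covered w∈ with ∈neighbours⁻ w∈
      ... | z , z∈I , w∈Nz =
        let z∈S₁ , z∈S₂ = x∈p∩q⁻ S₁ S₂ (p─q⊆p _ _ z∈I)
            z≢x = x∈p-y⇒x≢y z∈I
        in x∈p∩q⁺ (∈neighbours-shrink z∈S₁ z≢x w∈Nz , ∈neighbours-shrink z∈S₂ z≢x w∈Nz)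
      hall-∪ : ∣ S₁ ∪ S₂ ∣ ≤ ∣ A₁ ∪ A₂ ∣
      hall-∪ = ≤-trans (hall _ (λ z∈ → [ S₁⊆P , S₂⊆P ] (x∈p∪q⁻ S₁ S₂ z∈))) (p⊆q⇒∣p∣≤∣q∣ ∪-covered)
      hall-I : ∣ I ∣ ≤ ∣ A₁ ∩ A₂ ∣
      hall-I = ≤-trans (hall _ (λ z∈ → S₁⊆P (proj₁ (x∈p∩q⁻ S₁ S₂ (p─q⊆p _ _ z∈))))) (p⊆q⇒∣p∣≤∣q∣ I-covered)

    shrinkable : 2 ≤ ∣ N x ∣ → ∃ λ y → y ∈ N x × HallCondition P (shrink N x y)
    shrinkable 2≤∣Nx∣ with 2≤∣p∣⇒distinct 2≤∣Nx∣
    ... | y₁ , y₂ , y₁∈ , y₂∈ , y₁≢y₂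
        with anySubset? (deficient? P (shrink N x y₁)) | anySubset? (deficient? P (shrink N x y₂))
    ...   | no none₁     | _            = y₁ , y₁∈ , ¬deficient⇒hall none₁
    ...   | yes _        | no none₂     = y₂ , y₂∈ , ¬deficient⇒hall none₂
    ...   | yes (_ , d₁) | yes (_ , d₂) = ⊥-elim (not-both-deficient y₁≢y₂ d₁ d₂)

  hall-transversal : ∀ {P N} → HallCondition P N → Transversal P N
  hall-transversal {P} {N} = go (suc (μ N)) N ≤-refl
    where
    go : ∀ k N → μ N < k → HallCondition P N → Transversal P N
    go (suc k) N μN<1+k hall with any? (λ x → (x ∈? P) ×-dec (2 ≤? ∣ N x ∣))
    ... | no  allThin = hall-singletons hall (λ x∈P → s≤s⁻¹ (≰⇒> (λ 2≤ → allThin (_ , x∈P , 2≤))))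
    ... | yes (x , _ , 2≤∣Nx∣) with Shrinking.shrinkable hall 2≤∣Nx∣
    ...   | y , y∈ , hall' =
      transversal-mono (shrink-⊆ N x y) (go k _ (<-≤-trans (μ-shrink N x y∈) (s≤s⁻¹ μN<1+k)) hall')

record TightCover {a b} (F : Edges a b) (CA : Fin a → Set) (CB : Fin b → Set) : Set where
  field
    covers            : ∀ x y → T (F x y) → CA x ⊎ CB y
    partner           : ∀ {x} → CA x → Fin b
    partner-adjacent  : ∀ {x} (x∈ : CA x) → T (F x (partner x∈))
    partner∉          : ∀ {x} (x∈ : CA x) → ¬ CB (partner x∈)
    partner-injective : ∀ {x x'} (x∈ : CA x) (x'∈ : CA x') → partner x∈ ≡ partner x'∈ → x ≡ x'
    outside-neighbour : ∀ {y} → CB y → ∃ λ x → T (F x y) × ¬ CA x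

transpose : ∀ {a b} → Edges a b → Edges b a
transpose F y x = F x y

minCover-transpose : ∀ {a b} {F : Edges a b} {CA CB} →
  IsMinVertexCover F (CA , CB) → IsMinVertexCover (transpose F) (CB , CA)
minCover-transpose {CA = CA} {CB} (covers , minimal) =
  (λ y x e → Data.Sum.swap (covers x y e)) ,
  λ { (DB , DA) covers' → begin
        ∣ CB ∣ + ∣ CA ∣ ≡⟨ +-comm ∣ CB ∣ ∣ CA ∣ ⟩
        ∣ CA ∣ + ∣ CB ∣ ≤⟨ minimal (DA , DB) (λ x y e → Data.Sum.swap (covers' y x e)) ⟩
        ∣ DA ∣ + ∣ DB ∣ ≡⟨ +-comm ∣ DA ∣ ∣ DB ∣ ⟩
        ∣ DB ∣ + ∣ DA ∣ ∎ }
  where open ≤-Reasoning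

module MinCover {a b} {F : Edges a b} {CA CB} (minCover : IsMinVertexCover F (CA , CB)) where

  covers : IsVertexCover F (CA , CB)
  covers = proj₁ minCover

  covers-right : ∀ {x y} → T (F x y) → x ∉ CA → y ∈ CB
  covers-right {x} {y} e x∉CA = [ (λ x∈CA → ⊥-elim (x∉CA x∈CA)) , (λ y∈CB → y∈CB) ] (covers x y e)

  covers-left : ∀ {x y} → T (F x y) → y ∉ CB → x ∈ CA
  covers-left {x} {y} e y∉CB = [ (λ x∈CA → x∈CA) , (λ y∈CB → ⊥-elim (y∉CB y∈CB)) ] (covers x y e)

  no-smaller-cover : ∀ {DA DB} → IsVertexCover F (DA , DB) → ∣ DA ∣ + ∣ DB ∣ < ∣ CA ∣ + ∣ CB ∣ → ⊥
  no-smaller-cover covers' smaller = <⇒≱ smaller (proj₂ minCover _ covers')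

  outside-neighbour : ∀ {y} → y ∈ CB → ∃ λ x → T (F x y) × x ∉ CA
  outside-neighbour {y} y∈CB with any? (λ x → T? (F x y) ×-dec ¬? (x ∈? CA))
  ... | yes found = found
  ... | no  none  = ⊥-elim (no-smaller-cover covers' (+-monoʳ-< ∣ CA ∣ (x∈p⇒∣p-x∣<∣p∣ y∈CB)))
    where
    covers' : IsVertexCover F (CA , CB - y)
    covers' x y' e with x ∈? CA
    ... | yes x∈CA = inj₁ x∈CA
    ... | no  x∉CA with y' ≟ y
    ...   | yes refl = ⊥-elim (none (x , e , x∉CA))
    ...   | no  y'≢y = inj₂ (x∈p∧x≢y⇒x∈p-y (covers-right e x∉CA) y'≢y)

  neighbours∈cover⇒∉ : ∀ {y} → (∀ x → T (F x y) → x ∈ CA) → y ∉ CB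
  neighbours∈cover⇒∉ all∈ y∈CB with outside-neighbour y∈CB
  ... | x , e , x∉CA = x∉CA (all∈ x e)

  pendants⇒centre∈ : ∀ {c y₀ y₁} → y₀ ≢ y₁ → T (F c y₀) → T (F c y₁) →
    (∀ x → T (F x y₀) → x ≡ c) → (∀ x → T (F x y₁) → x ≡ c) → c ∈ CA
  pendants⇒centre∈ {c} {y₀} {y₁} y₀≢y₁ e₀ e₁ only₀ only₁ with c ∈? CA
  ... | yes c∈CA = c∈CA
  ... | no  c∉CA = ⊥-elim (no-smaller-cover covers' (begin-strict
    ∣ CA ∪ ⁅ c ⁆ ∣ + ∣ CB - y₀ - y₁ ∣          ≤⟨ +-monoˡ-≤ _ (∣p∪q∣≤∣p∣+∣q∣ CA ⁅ c ⁆) ⟩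
    ∣ CA ∣ + ∣ ⁅ c ⁆ ∣ + ∣ CB - y₀ - y₁ ∣      ≡⟨ cong (λ k → ∣ CA ∣ + k + ∣ CB - y₀ - y₁ ∣) (∣⁅x⁆∣≡1 c) ⟩
    ∣ CA ∣ + 1 + ∣ CB - y₀ - y₁ ∣              ≡⟨ +-assoc ∣ CA ∣ 1 _ ⟩
    ∣ CA ∣ + suc ∣ CB - y₀ - y₁ ∣              <⟨ +-monoʳ-< ∣ CA ∣ (n<1+n _) ⟩
    ∣ CA ∣ + suc (suc ∣ CB - y₀ - y₁ ∣)        ≡⟨ cong (∣ CA ∣ +_) ∣CB∣≡2+ ⟨
    ∣ CA ∣ + ∣ CB ∣                             ∎))
    where
    open ≤-Reasoning
    ∣CB∣≡2+ : ∣ CB ∣ ≡ suc (suc ∣ CB - y₀ - y₁ ∣)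
    ∣CB∣≡2+ = trans (x∈p⇒∣p∣≡1+∣p-x∣ (covers-right e₀ c∉CA))
                    (cong suc (x∈p⇒∣p∣≡1+∣p-x∣ (x∈p∧x≢y⇒x∈p-y (covers-right e₁ c∉CA) (y₀≢y₁ ∘ sym))))
    c∈ : ∀ {x} → x ≡ c → x ∈ CA ∪ ⁅ c ⁆
    c∈ refl = x∈p∪q⁺ (inj₂ (x∈⁅x⁆ c))
    covers' : IsVertexCover F (CA ∪ ⁅ c ⁆ , CB - y₀ - y₁)
    covers' x y e with y ≟ y₀ | y ≟ y₁
    ... | yes refl | _        = inj₁ (c∈ (only₀ x e))
    ... | no  _    | yes refl = inj₁ (c∈ (only₁ x e))
    ... | no y≢y₀  | no y≢y₁  = Data.Sum.map (λ x∈ → x∈p∪q⁺ (inj₁ x∈))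
                                    (λ y∈ → x∈p∧x≢y⇒x∈p-y (x∈p∧x≢y⇒x∈p-y y∈ y≢y₀) y≢y₁) (covers x y e)

  uncovered-neighbours : Fin a → Subset b
  uncovered-neighbours x = ⟦ (λ y → T? (F x y) ×-dec ¬? (y ∈? CB)) ⟧

  hall-condition : Hall.HallCondition CA uncovered-neighbours
  hall-condition S S⊆CA = ≮⇒≥ λ deficient → no-smaller-cover covers' (begin-strict
    ∣ CA ─ S ∣ + ∣ CB ∪ NS ∣              ≤⟨ +-monoʳ-≤ ∣ CA ─ S ∣ (∣p∪q∣≤∣p∣+∣q∣ CB NS) ⟩
    ∣ CA ─ S ∣ + (∣ CB ∣ + ∣ NS ∣)        <⟨ +-monoʳ-< ∣ CA ─ S ∣ (+-monoʳ-< ∣ CB ∣ deficient) ⟩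
    ∣ CA ─ S ∣ + (∣ CB ∣ + ∣ S ∣)         ≡⟨ cong (∣ CA ─ S ∣ +_) (+-comm (∣ CB ∣) (∣ S ∣)) ⟩
    ∣ CA ─ S ∣ + (∣ S ∣ + ∣ CB ∣)         ≡⟨ +-assoc (∣ CA ─ S ∣) (∣ S ∣) (∣ CB ∣) ⟨
    ∣ CA ─ S ∣ + ∣ S ∣ + ∣ CB ∣           ≡⟨ cong (_+ ∣ CB ∣) ∣CA─S∣+∣S∣≡∣CA∣ ⟩
    ∣ CA ∣ + ∣ CB ∣                        ∎)
    where
    open ≤-Reasoning
    NS = Hall.neighbours uncovered-neighbours S
    ∣CA─S∣+∣S∣≡∣CA∣ : ∣ CA ─ S ∣ + ∣ S ∣ ≡ ∣ CA ∣
    ∣CA─S∣+∣S∣≡∣CA∣ = trans (cong (∣ CA ─ S ∣ +_) (≤-antisym (p⊆q⇒∣p∣≤∣q∣ (λ x∈ → x∈p∩q⁺ (S⊆CA x∈ , x∈)))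
                                                             (∣p∩q∣≤∣q∣ CA S)))
                            (∣p─q∣+∣p∩q∣≡∣p∣ CA S)
    covers' : IsVertexCover F (CA ─ S , CB ∪ NS)
    covers' x y e with y ∈? CB | x ∈? S
    ... | yes y∈CB | _       = inj₂ (x∈p∪q⁺ (inj₁ y∈CB))
    ... | no  y∉CB | yes x∈S = inj₂ (x∈p∪q⁺ (inj₂ (Hall.∈neighbours⁺ x∈S (∈⟦⟧⁺ _ (e , y∉CB)))))
    ... | no  y∉CB | no  x∉S =
      inj₁ (x∈p∧x∉q⇒x∈p─q (covers-left e y∉CB) x∉S)

  tight : TightCover F (_∈ CA) (_∈ CB)
  tight = record
    { covers            = covers
    ; partner           = pick
    ; partner-adjacent  = λ x∈ → proj₁ (∈⟦⟧⁻ _ (pick∈ x∈))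
    ; partner∉          = λ x∈ → proj₂ (∈⟦⟧⁻ _ (pick∈ x∈))
    ; partner-injective = pick-injective
    ; outside-neighbour = outside-neighbour
    }
    where open Hall.Transversal (Hall.hall-transversal {N = uncovered-neighbours} hall-condition)

SaturatedB : ∀ {a b} → Edges a b → Fin b → Set
SaturatedB M y = ∃ λ x → T (M x y)

saturating⇒maximal : ∀ {a b} {F M : Edges a b} → IsMatching F M →
  (∀ x y → T (F x y) → SaturatedA M x ⊎ SaturatedB M y) → IsMaximalMatching F M
saturating⇒maximal {F = F} {M} matching saturating = matching , maximal
  where
  old : ∀ {x y x' y'} → T (M x' y') → T (addEdge M x y x' y')
  old m = Equivalence.from T-∨ (inj₁ m)
  new : ∀ {x y} → T (addEdge M x y x y)
  new {x} {y} = Equivalence.from (T-∨ {M x y})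
    (inj₂ (Equivalence.from T-∧ (fromWitness {a? = x ≟ x} refl , fromWitness {a? = y ≟ y} refl)))
  maximal : ∀ x y → T (F x y) → ¬ T (M x y) → ¬ IsMatching F (addEdge M x y)
  maximal x y e x≁y (_ , functional , injective) with saturating x y e
  ... | inj₁ (y' , m) = x≁y (subst (T ∘ M x) (sym (functional x y y' new (old m))) m)
  ... | inj₂ (x' , m) = x≁y (subst (λ x'' → T (M x'' y)) (sym (injective x x' y new (old m))) m)

module StView (m n : ℕ) where

  fromX : XView m n → Fin (StX m n)
  fromX (xU u)  = u ↑ˡ (n + (m + m))
  fromX (xC v)  = m ↑ʳ (v ↑ˡ (m + m))
  fromX (xL₀ u) = m ↑ʳ (n ↑ʳ (u ↑ˡ m))
  fromX (xL₁ u) = m ↑ʳ (n ↑ʳ (m ↑ʳ u))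

  fromY : YView m n → Fin (StY m n)
  fromY (yV v)  = v ↑ˡ (m + (n + n))
  fromY (yC u)  = n ↑ʳ (u ↑ˡ (n + n))
  fromY (yL₀ v) = n ↑ʳ (m ↑ʳ (v ↑ˡ n))
  fromY (yL₁ v) = n ↑ʳ (m ↑ʳ (n ↑ʳ v))

  viewX-fromX : ∀ xv → viewX m n (fromX xv) ≡ xv
  viewX-fromX (xU u)  rewrite splitAt-↑ˡ m u (n + (m + m)) = refl
  viewX-fromX (xC v)  rewrite splitAt-↑ʳ m (n + (m + m)) (v ↑ˡ (m + m)) | splitAt-↑ˡ n v (m + m) = refl
  viewX-fromX (xL₀ u) rewrite splitAt-↑ʳ m (n + (m + m)) (n ↑ʳ (u ↑ˡ m)) | splitAt-↑ʳ n (m + m) (u ↑ˡ m)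
                            | splitAt-↑ˡ m u m = refl
  viewX-fromX (xL₁ u) rewrite splitAt-↑ʳ m (n + (m + m)) (n ↑ʳ (m ↑ʳ u)) | splitAt-↑ʳ n (m + m) (m ↑ʳ u)
                            | splitAt-↑ʳ m m u = refl

  viewY-fromY : ∀ yv → viewY m n (fromY yv) ≡ yv
  viewY-fromY (yV v)  rewrite splitAt-↑ˡ n v (m + (n + n)) = refl
  viewY-fromY (yC u)  rewrite splitAt-↑ʳ n (m + (n + n)) (u ↑ˡ (n + n)) | splitAt-↑ˡ m u (n + n) = refl
  viewY-fromY (yL₀ v) rewrite splitAt-↑ʳ n (m + (n + n)) (m ↑ʳ (v ↑ˡ n)) | splitAt-↑ʳ m (n + n) (v ↑ˡ n)
                            | splitAt-↑ˡ n v n = refl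
  viewY-fromY (yL₁ v) rewrite splitAt-↑ʳ n (m + (n + n)) (m ↑ʳ (n ↑ʳ v)) | splitAt-↑ʳ m (n + n) (n ↑ʳ v)
                            | splitAt-↑ʳ n n v = refl

  fromX-viewX : ∀ i → fromX (viewX m n i) ≡ i
  fromX-viewX i with splitAt m i in e₁
  ... | inj₁ u = splitAt⁻¹-↑ˡ e₁
  ... | inj₂ j with splitAt n j in e₂
  ...   | inj₁ v = trans (cong (m ↑ʳ_) (splitAt⁻¹-↑ˡ e₂)) (splitAt⁻¹-↑ʳ e₁)
  ...   | inj₂ k with splitAt m k in e₃
  ...     | inj₁ u = trans (cong (λ z → m ↑ʳ (n ↑ʳ z)) (splitAt⁻¹-↑ˡ e₃))
                           (trans (cong (m ↑ʳ_) (splitAt⁻¹-↑ʳ e₂)) (splitAt⁻¹-↑ʳ e₁))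
  ...     | inj₂ u = trans (cong (λ z → m ↑ʳ (n ↑ʳ z)) (splitAt⁻¹-↑ʳ e₃))
                           (trans (cong (m ↑ʳ_) (splitAt⁻¹-↑ʳ e₂)) (splitAt⁻¹-↑ʳ e₁))

  fromY-viewY : ∀ j → fromY (viewY m n j) ≡ j
  fromY-viewY j with splitAt n j in e₁
  ... | inj₁ v = splitAt⁻¹-↑ˡ e₁
  ... | inj₂ k with splitAt m k in e₂
  ...   | inj₁ u = trans (cong (n ↑ʳ_) (splitAt⁻¹-↑ˡ e₂)) (splitAt⁻¹-↑ʳ e₁)
  ...   | inj₂ l with splitAt n l in e₃
  ...     | inj₁ v = trans (cong (λ z → n ↑ʳ (m ↑ʳ z)) (splitAt⁻¹-↑ˡ e₃))
                           (trans (cong (n ↑ʳ_) (splitAt⁻¹-↑ʳ e₂)) (splitAt⁻¹-↑ʳ e₁))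
  ...     | inj₂ v = trans (cong (λ z → n ↑ʳ (m ↑ʳ z)) (splitAt⁻¹-↑ʳ e₃))
                           (trans (cong (n ↑ʳ_) (splitAt⁻¹-↑ʳ e₂)) (splitAt⁻¹-↑ʳ e₁))

  viewX≡⇒≡fromX : ∀ {i xv} → viewX m n i ≡ xv → i ≡ fromX xv
  viewX≡⇒≡fromX {i} eq = trans (sym (fromX-viewX i)) (cong fromX eq)

  viewY≡⇒≡fromY : ∀ {j yv} → viewY m n j ≡ yv → j ≡ fromY yv
  viewY≡⇒≡fromY {j} eq = trans (sym (fromY-viewY j)) (cong fromY eq)

  viewX-injective : ∀ {i i'} → viewX m n i ≡ viewX m n i' → i ≡ i'
  viewX-injective {i' = i'} eq = trans (viewX≡⇒≡fromX eq) (fromX-viewX i')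

  viewY-injective : ∀ {j j'} → viewY m n j ≡ viewY m n j' → j ≡ j'
  viewY-injective {j' = j'} eq = trans (viewY≡⇒≡fromY eq) (fromY-viewY j')

  fromX-injective : ∀ {xv xv'} → fromX xv ≡ fromX xv' → xv ≡ xv'
  fromX-injective {xv} {xv'} eq = trans (sym (viewX-fromX xv)) (trans (cong (viewX m n) eq) (viewX-fromX xv'))

  fromY-injective : ∀ {yv yv'} → fromY yv ≡ fromY yv' → yv ≡ yv'
  fromY-injective {yv} {yv'} eq = trans (sym (viewY-fromY yv)) (trans (cong (viewY m n) eq) (viewY-fromY yv'))

  St-fromView : ∀ {E : Edges m n} xv yv → T (stEdge E xv yv) → T (St E (fromX xv) (fromY yv))
  St-fromView {E} xv yv = subst₂ (λ x y → T (stEdge E x y)) (sym (viewX-fromX xv)) (sym (viewY-fromY yv))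

  stCoverX : (Fin m → Set) → XView m n → Set
  stCoverX CU (xU u)  = CU u
  stCoverX CU (xC v)  = ⊤
  stCoverX CU (xL₀ u) = ⊥
  stCoverX CU (xL₁ u) = ⊥

  stCoverY : (Fin n → Set) → YView m n → Set
  stCoverY CV (yV v)  = CV v
  stCoverY CV (yC u)  = ⊤
  stCoverY CV (yL₀ v) = ⊥
  stCoverY CV (yL₁ v) = ⊥

module KőnigMatching {m n} (E : Edges m n) {CU : Fin m → Set} (CU? : Decidable CU) {CV : Fin n → Set}
                     (tight : TightCover E CU CV) where

  open StView m n

  open TightCover tight

  mate : Fin m → Maybe (Fin n)
  mate u with CU? u
  ... | yes u∈ = just (partner u∈)
  ... | no  _  = nothing

  mate-just : ∀ {u v} → mate u ≡ just v → ∃ λ (u∈ : CU u) → partner u∈ ≡ v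
  mate-just {u} eq with CU? u
  mate-just refl | yes u∈ = u∈ , refl

  mate-nothing : ∀ {u} → ¬ CU u → mate u ≡ nothing
  mate-nothing {u} u∉ with CU? u
  ... | yes u∈ = ⊥-elim (u∉ u∈)
  ... | no  _  = refl

  mate-defined : ∀ {u} → CU u → ∃ λ v → mate u ≡ just v
  mate-defined {u} u∈ with CU? u
  ... | yes u∈' = partner u∈' , refl
  ... | no  u∉  = ⊥-elim (u∉ u∈)

  data Mate : XView m n → YView m n → Set where
    u─v   : ∀ {u v} → mate u ≡ just v → Mate (xU u) (yV v)
    u─cu  : ∀ {u} → ¬ CU u → Mate (xU u) (yC u)
    l₀─cu : ∀ {u} → CU u → Mate (xL₀ u) (yC u)
    cv─l₀ : ∀ {v} → Mate (xC v) (yL₀ v)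

  mate? : ∀ xv yv → Dec (Mate xv yv)
  mate? (xU u) (yV v) = Dec.map′ u─v (λ { (u─v eq) → eq }) (≡-decMaybe _≟_ (mate u) (just v))
  mate? (xU u) (yC u') with u ≟ u'
  ... | yes refl = Dec.map′ u─cu (λ { (u─cu u∉) → u∉ }) (¬? (CU? u))
  ... | no  u≢u' = no λ { (u─cu _) → u≢u' refl }
  mate? (xL₀ u) (yC u') with u ≟ u'
  ... | yes refl = Dec.map′ l₀─cu (λ { (l₀─cu u∈) → u∈ }) (CU? u)
  ... | no  u≢u' = no λ { (l₀─cu _) → u≢u' refl }
  mate? (xC v) (yL₀ v') with v ≟ v'
  ... | yes refl = yes cv─l₀
  ... | no  v≢v' = no λ { cv─l₀ → v≢v' refl }
  mate? (xU _)  (yL₀ _) = no λ ()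
  mate? (xU _)  (yL₁ _) = no λ ()
  mate? (xC _)  (yV _)  = no λ ()
  mate? (xC _)  (yC _)  = no λ ()
  mate? (xC _)  (yL₁ _) = no λ ()
  mate? (xL₀ _) (yV _)  = no λ ()
  mate? (xL₀ _) (yL₀ _) = no λ ()
  mate? (xL₀ _) (yL₁ _) = no λ ()
  mate? (xL₁ _) _       = no λ ()

  Mate⇒edge : ∀ {xv yv} → Mate xv yv → T (stEdge E xv yv)
  Mate⇒edge (u─v eq) with mate-just eq
  ... | u∈ , refl = partner-adjacent u∈
  Mate⇒edge (u─cu _)  = fromWitness refl
  Mate⇒edge (l₀─cu _) = fromWitness refl
  Mate⇒edge cv─l₀     = fromWitness refl

  Mate-functional : ∀ {xv yv yv'} → Mate xv yv → Mate xv yv' → yv ≡ yv'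
  Mate-functional (u─v eq) (u─v eq') = cong yV (just-injective (trans (sym eq) eq'))
  Mate-functional (u─v eq) (u─cu u∉) = ⊥-elim (u∉ (proj₁ (mate-just eq)))
  Mate-functional (u─cu u∉) (u─v eq) = ⊥-elim (u∉ (proj₁ (mate-just eq)))
  Mate-functional (u─cu _) (u─cu _)  = refl
  Mate-functional (l₀─cu _) (l₀─cu _) = refl
  Mate-functional cv─l₀ cv─l₀         = refl

  Mate-injective : ∀ {xv xv' yv} → Mate xv yv → Mate xv' yv → xv ≡ xv'
  Mate-injective (u─v eq) (u─v eq') with mate-just eq | mate-just eq'
  ... | u∈ , refl | u'∈ , same = cong xU (partner-injective u∈ u'∈ (sym same))
  Mate-injective (u─cu _)    (u─cu _)  = refl
  Mate-injective (u─cu u∉)   (l₀─cu u∈) = ⊥-elim (u∉ u∈)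
  Mate-injective (l₀─cu u∈)  (u─cu u∉) = ⊥-elim (u∉ u∈)
  Mate-injective (l₀─cu _)   (l₀─cu _) = refl
  Mate-injective cv─l₀ cv─l₀ = refl

  centre-mate : ∀ u → ∃ λ xv → Mate xv (yC u)
  centre-mate u with CU? u
  ... | yes u∈ = xL₀ u , l₀─cu u∈
  ... | no  u∉ = xU u , u─cu u∉

  U-mate : ∀ u → ∃ (Mate (xU u))
  U-mate u with CU? u
  ... | no  u∉ = yC u , u─cu u∉
  ... | yes u∈ with mate-defined u∈
  ...   | v , eq = yV v , u─v eq

  edge-has-mate : ∀ xv yv → T (stEdge E xv yv) → ∃ (Mate xv) ⊎ ∃ (λ xv' → Mate xv' yv)
  edge-has-mate (xU u)  _       _ = inj₁ (U-mate u)
  edge-has-mate (xC v)  _       _ = inj₁ (yL₀ v , cv─l₀)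
  edge-has-mate (xL₀ _) (yC u') _ = inj₂ (centre-mate u')
  edge-has-mate (xL₁ _) (yC u') _ = inj₂ (centre-mate u')

  M : Edges (StX m n) (StY m n)
  M i j = ⌊ mate? (viewX m n i) (viewY m n j) ⌋

  M⇒Mate : ∀ {i j} → T (M i j) → Mate (viewX m n i) (viewY m n j)
  M⇒Mate = toWitness

  Mate⇒M : ∀ {xv yv} → Mate xv yv → T (M (fromX xv) (fromY yv))
  Mate⇒M {xv} {yv} mt = fromWitness (subst₂ Mate (sym (viewX-fromX xv)) (sym (viewY-fromY yv)) mt)

  ¬Mate⇒¬M : ∀ xv yv → ¬ Mate xv yv → ¬ T (M (fromX xv) (fromY yv))
  ¬Mate⇒¬M xv yv ¬mt mij = ¬mt (subst₂ Mate (viewX-fromX xv) (viewY-fromY yv) (M⇒Mate mij))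

  saturatedA : ∀ {i yv} → Mate (viewX m n i) yv → SaturatedA M i
  saturatedA {yv = yv} mt = fromY yv , fromWitness (subst (Mate _) (sym (viewY-fromY yv)) mt)

  saturatedB : ∀ {j xv} → Mate xv (viewY m n j) → SaturatedB M j
  saturatedB {xv = xv} mt = fromX xv , fromWitness (subst (λ xv' → Mate xv' _) (sym (viewX-fromX xv)) mt)

  isMatching : IsMatching (St E) M
  isMatching = (λ _ _ → Mate⇒edge ∘ M⇒Mate)
             , (λ _ _ _ mij mij' → viewY-injective (Mate-functional (M⇒Mate mij) (M⇒Mate mij')))
             , (λ _ _ _ mij mi'j → viewX-injective (Mate-injective (M⇒Mate mij) (M⇒Mate mi'j)))

  isMaximal : IsMaximalMatching (St E) M
  isMaximal = saturating⇒maximal isMatching λ i j e →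
    Data.Sum.map (saturatedA ∘ proj₂) (saturatedB ∘ proj₂) (edge-has-mate (viewX m n i) (viewY m n j) e)

  ZView : Fin (StX m n) ⊎ Fin (StY m n) → Set
  ZView (inj₁ i) = ¬ stCoverX CU (viewX m n i)
  ZView (inj₂ j) = stCoverY CV (viewY m n j)

  unmatched⇒outside : ∀ xv → ¬ ∃ (Mate xv) → ¬ stCoverX CU xv
  unmatched⇒outside (xU u)  unmatched _ = unmatched (U-mate u)
  unmatched⇒outside (xC v)  unmatched _ = unmatched (yL₀ v , cv─l₀)
  unmatched⇒outside (xL₀ _) _ ()
  unmatched⇒outside (xL₁ _) _ ()

  edge⇒stCoverY : ∀ xv yv → ¬ stCoverX CU xv → T (stEdge E xv yv) → stCoverY CV yv
  edge⇒stCoverY (xU u)  (yV v) u∉ e = [ ⊥-elim ∘ u∉ , (λ v∈ → v∈) ] (covers u v e)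
  edge⇒stCoverY (xU _)  (yC _) _ _  = tt
  edge⇒stCoverY (xL₀ _) (yC _) _ _  = tt
  edge⇒stCoverY (xL₁ _) (yC _) _ _  = tt
  edge⇒stCoverY (xC _)  _      out _ = ⊥-elim (out tt)

  Mate⇒outside : ∀ {xv yv} → stCoverY CV yv → Mate xv yv → ¬ stCoverX CU xv
  Mate⇒outside v∈ (u─v eq) _ with mate-just eq
  ... | u∈ , refl = partner∉ u∈ v∈
  Mate⇒outside _ (u─cu u∉) = u∉
  Mate⇒outside _ (l₀─cu _) = λ ()
  Mate⇒outside () cv─l₀

  sound : ∀ {p} → Z (St E) M p → ZView p
  sound (start {x} unsaturated) = unmatched⇒outside (viewX m n x) (unsaturated ∘ saturatedA ∘ proj₂)
  sound (nonM {x} {y} z e _)    = edge⇒stCoverY (viewX m n x) (viewY m n y) (sound z) e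
  sound (viaM z mij)            = Mate⇒outside (sound z) (M⇒Mate mij)

  unsaturated : ∀ xv → (∀ {yv} → ¬ Mate xv yv) → ¬ SaturatedA M (fromX xv)
  unsaturated xv unmatched (_ , mij) = unmatched (subst (λ xv' → Mate xv' _) (viewX-fromX xv) (M⇒Mate mij))

  reach-L₁ : ∀ u → Z (St E) M (inj₁ (fromX (xL₁ u)))
  reach-L₁ u = start (unsaturated (xL₁ u) λ ())

  reach-cu : ∀ u → Z (St E) M (inj₂ (fromY (yC u)))
  reach-cu u = nonM (reach-L₁ u) (St-fromView (xL₁ u) (yC u) (fromWitness refl))
                                 (¬Mate⇒¬M (xL₁ u) (yC u) λ ())

  reach-L₀ : ∀ u → Z (St E) M (inj₁ (fromX (xL₀ u)))
  reach-L₀ u with CU? u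
  ... | yes u∈ = viaM (reach-cu u) (Mate⇒M (l₀─cu u∈))
  ... | no  u∉ = start (unsaturated (xL₀ u) λ { (l₀─cu u∈) → u∉ u∈ })

  reach-U : ∀ {u} → ¬ CU u → Z (St E) M (inj₁ (fromX (xU u)))
  reach-U u∉ = viaM (reach-cu _) (Mate⇒M (u─cu u∉))

  reach-V : ∀ {v} → CV v → Z (St E) M (inj₂ (fromY (yV v)))
  reach-V v∈ with outside-neighbour v∈
  ... | u , e , u∉ = nonM (reach-U u∉) (St-fromView (xU u) (yV _) e) (¬Mate⇒¬M (xU u) (yV _) unmatched)
    where
    nothing≢just : ∀ {v : Fin n} → nothing ≢ just v
    nothing≢just ()
    unmatched : ∀ {v} → ¬ Mate (xU u) (yV v)
    unmatched (u─v eq) = nothing≢just (trans (sym (mate-nothing u∉)) eq)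

  complete₁ : ∀ (xv : XView m n) → ¬ stCoverX CU xv → Z (St E) M (inj₁ (fromX xv))
  complete₁ (xU u)  u∉  = reach-U u∉
  complete₁ (xC v)  out = ⊥-elim (out tt)
  complete₁ (xL₀ u) _   = reach-L₀ u
  complete₁ (xL₁ u) _   = reach-L₁ u

  complete₂ : ∀ (yv : YView m n) → stCoverY CV yv → Z (St E) M (inj₂ (fromY yv))
  complete₂ (yV v) v∈ = reach-V v∈
  complete₂ (yC u) _  = reach-cu u

  stCoverX? : ∀ (xv : XView m n) → Dec (stCoverX CU xv)
  stCoverX? (xU u)  = CU? u
  stCoverX? (xC v)  = yes tt
  stCoverX? (xL₀ u) = no λ ()
  stCoverX? (xL₁ u) = no λ ()

  KA⇔stCoverX : ∀ i → KA (St E) M i ⇔ stCoverX CU (viewX m n i)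
  KA⇔stCoverX i = mk⇔
    (λ notZ → decidable-stable (stCoverX? (viewX m n i))
                     (λ out → notZ (subst (Z _ _ ∘ inj₁) (fromX-viewX i) (complete₁ (viewX m n i) out))))
    (λ inCover z → sound z inCover)

  KB⇔stCoverY : ∀ j → KB (St E) M j ⇔ stCoverY CV (viewY m n j)
  KB⇔stCoverY j =
    mk⇔ sound (λ inCover → subst (Z _ _ ∘ inj₂) (fromY-viewY j) (complete₂ (viewY m n j) inCover))

  KA⇔cover-U : ∀ u → KA (St E) M (embU n u) ⇔ CU u
  KA⇔cover-U u = subst (λ xv → KA (St E) M (embU n u) ⇔ stCoverX CU xv)
                       (viewX-fromX (xU u)) (KA⇔stCoverX (embU n u))

  KB⇔cover-V : ∀ v → KB (St E) M (embV m v) ⇔ CV v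
  KB⇔cover-V v = subst (λ yv → KB (St E) M (embV m v) ⇔ stCoverY CV yv)
                       (viewY-fromY (yV v)) (KB⇔stCoverY (embV m v))

module StNeighbours {m n : ℕ} (E : Edges m n) where

  open StView m n

  only-neighbourX : ∀ yv {c} → (∀ xv → T (stEdge E xv yv) → xv ≡ c) →
    ∀ i → T (St E i (fromY yv)) → i ≡ fromX c
  only-neighbourX yv only i e = viewX≡⇒≡fromX (only _ (subst (T ∘ stEdge E (viewX m n i)) (viewY-fromY yv) e))

  only-neighbourY : ∀ xv {c} → (∀ yv → T (stEdge E xv yv) → yv ≡ c) →
    ∀ j → T (St E (fromX xv) j) → j ≡ fromY c
  only-neighbourY xv only j e =
    viewY≡⇒≡fromY (only _ (subst (λ xv' → T (stEdge E xv' (viewY m n j))) (viewX-fromX xv) e))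

  yL₀-neighbour : ∀ {v} xv → T (stEdge E xv (yL₀ v)) → xv ≡ xC v
  yL₀-neighbour (xC _) e = cong xC (toWitness e)

  yL₁-neighbour : ∀ {v} xv → T (stEdge E xv (yL₁ v)) → xv ≡ xC v
  yL₁-neighbour (xC _) e = cong xC (toWitness e)

  xL₀-neighbour : ∀ {u} yv → T (stEdge E (xL₀ u) yv) → yv ≡ yC u
  xL₀-neighbour (yC _) e = cong yC (sym (toWitness e))

  xL₁-neighbour : ∀ {u} yv → T (stEdge E (xL₁ u) yv) → yv ≡ yC u
  xL₁-neighbour (yC _) e = cong yC (sym (toWitness e))

module MinCoverOfSt {m n : ℕ} (E : Edges m n) {CX CY} (minCover : IsMinVertexCover (St E) (CX , CY)) where

  open StView m n
  open StNeighbours E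
  open MinCover minCover using (covers; pendants⇒centre∈; neighbours∈cover⇒∉; tight)
  private
    module ᵀ = MinCover (minCover-transpose minCover)

  centreV∈ : ∀ v → fromX (xC v) ∈ CX
  centreV∈ v = pendants⇒centre∈ (leaves-differ ∘ fromY-injective)
    (St-fromView (xC v) (yL₀ v) (fromWitness refl)) (St-fromView (xC v) (yL₁ v) (fromWitness refl))
    (only-neighbourX (yL₀ v) yL₀-neighbour) (only-neighbourX (yL₁ v) yL₁-neighbour)
    where
    leaves-differ : yL₀ {m} v ≢ yL₁ v
    leaves-differ ()

  centreU∈ : ∀ u → fromY (yC u) ∈ CY
  centreU∈ u = ᵀ.pendants⇒centre∈ (leaves-differ ∘ fromX-injective)
    (St-fromView (xL₀ u) (yC u) (fromWitness refl)) (St-fromView (xL₁ u) (yC u) (fromWitness refl))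
    (only-neighbourY (xL₀ u) xL₀-neighbour) (only-neighbourY (xL₁ u) xL₁-neighbour)
    where
    leaves-differ : xL₀ {n = n} u ≢ xL₁ u
    leaves-differ ()

  leafV∉ : ∀ {v} yv → (∀ xv → T (stEdge E xv yv) → xv ≡ xC v) → fromY yv ∉ CY
  leafV∉ {v} yv only = neighbours∈cover⇒∉ λ i e → subst (_∈ CX) (sym (only-neighbourX yv only i e)) (centreV∈ v)

  leafU∉ : ∀ {u} xv → (∀ yv → T (stEdge E xv yv) → yv ≡ yC u) → fromX xv ∉ CX
  leafU∉ {u} xv only = ᵀ.neighbours∈cover⇒∉ λ j e → subst (_∈ CY) (sym (only-neighbourY xv only j e)) (centreU∈ u)

  CU : Fin m → Set
  CU u = fromX (xU u) ∈ CX

  CV : Fin n → Set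
  CV v = fromY (yV v) ∈ CY

  CX⇔stCover : ∀ i → i ∈ CX ⇔ stCoverX CU (viewX m n i)
  CX⇔stCover i = subst (λ i' → i' ∈ CX ⇔ stCoverX CU (viewX m n i)) (fromX-viewX i) (onView (viewX m n i))
    where
    onView : ∀ xv → fromX xv ∈ CX ⇔ stCoverX CU xv
    onView (xU u)  = mk⇔ (λ u∈ → u∈) (λ u∈ → u∈)
    onView (xC v)  = mk⇔ (λ _ → tt) (λ _ → centreV∈ v)
    onView (xL₀ u) = mk⇔ (leafU∉ (xL₀ u) xL₀-neighbour) λ ()
    onView (xL₁ u) = mk⇔ (leafU∉ (xL₁ u) xL₁-neighbour) λ ()

  CY⇔stCover : ∀ j → j ∈ CY ⇔ stCoverY CV (viewY m n j)
  CY⇔stCover j = subst (λ j' → j' ∈ CY ⇔ stCoverY CV (viewY m n j)) (fromY-viewY j) (onView (viewY m n j))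
    where
    onView : ∀ yv → fromY yv ∈ CY ⇔ stCoverY CV yv
    onView (yV v)  = mk⇔ (λ v∈ → v∈) (λ v∈ → v∈)
    onView (yC u)  = mk⇔ (λ _ → tt) (λ _ → centreU∈ u)
    onView (yL₀ v) = mk⇔ (leafV∉ (yL₀ v) yL₀-neighbour) λ ()
    onView (yL₁ v) = mk⇔ (leafV∉ (yL₁ v) yL₁-neighbour) λ ()

  uncovered-neighbourU : ∀ {u j} → T (St E (fromX (xU u)) j) → j ∉ CY → ∃ λ v → j ≡ fromY (yV v) × T (E u v)
  uncovered-neighbourU {u} {j} e j∉ =
    onView (viewY m n j) refl (subst (λ xv → T (stEdge E xv (viewY m n j))) (viewX-fromX (xU u)) e)
    where
    onView : ∀ yv → viewY m n j ≡ yv → T (stEdge E (xU u) yv) → ∃ λ v → j ≡ fromY (yV v) × T (E u v)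
    onView (yV v)  eq e' = v , viewY≡⇒≡fromY eq , e'
    onView (yC u') eq e' with toWitness e'
    ... | refl = ⊥-elim (j∉ (subst (_∈ CY) (sym (viewY≡⇒≡fromY eq)) (centreU∈ u)))

  uncovered-neighbourV : ∀ {v i} → T (St E i (fromY (yV v))) → i ∉ CX → ∃ λ u → i ≡ fromX (xU u) × T (E u v)
  uncovered-neighbourV {v} {i} e i∉ =
    onView (viewX m n i) refl (subst (T ∘ stEdge E (viewX m n i)) (viewY-fromY (yV v)) e)
    where
    onView : ∀ xv → viewX m n i ≡ xv → T (stEdge E xv (yV v)) → ∃ λ u → i ≡ fromX (xU u) × T (E u v)
    onView (xU u)  eq e' = u , viewX≡⇒≡fromX eq , e'
    onView (xC v') eq e' with toWitness e'
    ... | refl = ⊥-elim (i∉ (subst (_∈ CX) (sym (viewX≡⇒≡fromX eq)) (centreV∈ v)))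

  trace-tight : TightCover E CU CV
  trace-tight = record
    { covers            = λ u v e → covers (fromX (xU u)) (fromY (yV v)) (St-fromView (xU u) (yV v) e)
    ; partner           = partner
    ; partner-adjacent  = λ u∈ → proj₂ (proj₂ (partner-in-V u∈))
    ; partner∉          = λ u∈ v∈ → St.partner∉ u∈ (subst (_∈ CY) (sym (partner≡ u∈)) v∈)
    ; partner-injective = λ u∈ u'∈ same → xU-injective (fromX-injective (St.partner-injective u∈ u'∈
                            (trans (partner≡ u∈) (trans (cong (fromY ∘ yV) same) (sym (partner≡ u'∈))))))
    ; outside-neighbour = outside-neighbour
    }
    where
    module St = TightCover tight
    partner-in-V : ∀ {u} (u∈ : CU u) → ∃ λ v → St.partner u∈ ≡ fromY (yV v) × T (E u v)
    partner-in-V u∈ = uncovered-neighbourU (St.partner-adjacent u∈) (St.partner∉ u∈)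
    partner : ∀ {u} → CU u → Fin n
    partner u∈ = proj₁ (partner-in-V u∈)
    partner≡ : ∀ {u} (u∈ : CU u) → St.partner u∈ ≡ fromY (yV (partner u∈))
    partner≡ u∈ = proj₁ (proj₂ (partner-in-V u∈))
    outside-neighbour : ∀ {v} → CV v → ∃ λ u → T (E u v) × ¬ CU u
    outside-neighbour v∈ with St.outside-neighbour v∈
    ... | i , e , i∉ with uncovered-neighbourV e i∉
    ...   | u , refl , e' = u , e' , i∉
    xU-injective : ∀ {u u'} → xU {n = n} u ≡ xU u' → u ≡ u'
    xU-injective refl = refl

⇔-pair : ∀ {A B : Set} → A ⇔ B → (A → B) × (B → A)
⇔-pair A⇔B = Equivalence.to A⇔B , Equivalence.from A⇔B

minCover-St-isKőnig : ∀ {m n} (E : Edges m n) (C : VSet (StX m n) (StY m n)) →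
  IsMinVertexCover (St E) C → ∃ λ M → IsMaximalMatching (St E) M × CoverIsKonig (St E) M C
minCover-St-isKőnig {m} {n} E (CX , CY) minCover =
  M , isMaximal , (λ i → ⇔-pair (⇔.trans (CX⇔stCover i) (⇔.sym (KA⇔stCoverX i))))
                , (λ j → ⇔-pair (⇔.trans (CY⇔stCover j) (⇔.sym (KB⇔stCoverY j))))
  where
  open StView m n
  open MinCoverOfSt E minCover
  open KőnigMatching E (λ u → fromX (xU u) ∈? CX) trace-tight

minCover-Kőnig-trace : ∀ {m n} (E : Edges m n) CU CV → IsMinVertexCover E (CU , CV) →
  ∃ λ M → IsMaximalMatching (St E) M ×
    ((u : Fin m) → (KA (St E) M (embU n u) → u ∈ CU) × (u ∈ CU → KA (St E) M (embU n u))) ×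
    ((v : Fin n) → (KB (St E) M (embV m v) → v ∈ CV) × (v ∈ CV → KB (St E) M (embV m v)))
minCover-Kőnig-trace E CU CV minCover =
  M , isMaximal , (λ u → ⇔-pair (KA⇔cover-U u)) , (λ v → ⇔-pair (KB⇔cover-V v))
  where open KőnigMatching E (_∈? CU) (MinCover.tight minCover)

theorem3p11 : (m n : ℕ) (E : Edges m n) → Connected E → m ≤ n →
    ((C : VSet (StX m n) (StY m n)) → IsMinVertexCover (St E) C →
       ∃ λ M → IsMaximalMatching (St E) M × CoverIsKonig (St E) M C)
    ×
    ((CU : _) (CV : _) → IsMinVertexCover E (CU , CV) →
       ∃ λ M → IsMaximalMatching (St E) M ×
         ((u : Fin m) → (KA (St E) M (embU n u) → u ∈ CU) × (u ∈ CU → KA (St E) M (embU n u))) ×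
         ((v : Fin n) → (KB (St E) M (embV m v) → v ∈ CV) × (v ∈ CV → KB (St E) M (embV m v))))
theorem3p11 m n E _ _ = minCover-St-isKőnig E , minCover-Kőnig-trace E
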